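{- Let $M=(E,\mathcal I)$ be a matroid, let $(X,Y)$ be a partition of $E$, and let $B_X$ be a basis of $M|X$ and $B_Y$ a basis of $M|Y$. Then (i) $\mathrm{del}(B_X,B_Y)=|F|$ for any $F\subseteq B_X\cup B_Y$ such that $(B_X\cup B_Y)\setminus F$ is a basis of $M$; (ii) $\mathrm{del}(B_X,B_Y)=|F|$ for any $F\subseteq B_X$ such that $(B_X\setminus F)\cup B_Y$ is a basis of $M$; (iii) $\mathrm{del}(B_X,B_Y)=\mathrm{del}(B'_X,B'_Y)$ for every basis $B'_X$ of $M|X$ and every basis $B'_Y$ of $M|Y$.
   Context: Matroids may be infinite. A matroid is a pair $M=(E,\mathcal I)$ with $\mathcal I$ a set of subsets of $E$ (the independent sets) such that: (I1) $\emptyset\in\mathcal I$; (I2) $\mathcal I$ is closed under subsets; (I3) for every $I\in\mathcal I$ that is not $\subseteq$-maximal in $\mathcal I$ and every $\subseteq$-maximal $I'\in\mathcal I$ there is $x\in I'\setminus I$ with $I\cup\{x\}\in\mathcal I$; (IM) whenever $I\subseteq X\subseteq E$ and $I\in\mathcal I$, the set $\{I'\in\mathcal I: I\subseteq I'\subseteq X\}$ has a maximal element. Bases are maximal independent sets. $M|X$ is the matroid on $X$ whose independent sets are the independent sets of $M$ contained in $X$. For independent sets $I,J$, $\mathrm{del}(I,J):=\min\{|F|: F\subseteq I\cup J,\ (I\cup J)\setminus F\in\mathcal I\}$, with $\mathrm{del}(I,J)=\infty$ if there is no finite such $F$. Cardinalities $|F|$ of infinite sets are compared with $\infty$ in the sense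 that any infinite $F$ counts as $\infty$. -}

module Defs where

open import Level using (0ℓ)
open import Data.Nat using (ℕ; _≤_)
open import Data.Fin using (Fin)
open import Data.Maybe using (Maybe; just; nothing)
open import Data.Product using (Σ; ∃; _×_; _,_)
open import Data.Sum using (_⊎_)
open import Relation.Nullary using (¬_)
open import Data.Empty using (⊥)
open import Relation.Binary.PropositionalEquality using (_≡_)
open import Relation.Unary using (Pred; _∈_; _∉_; _⊆_; _∪_; _∖_; ∅; ｛_｝)
open import Function.Definitions using (Injective)
open import Function.Bundles using (_⇔_)

-- Subsets of a ground set E are predicates E → Set (extensional: all
-- notions below only use membership, and independence is ⊆-downclosed).
Subset : Set → Set₁
Subset E = Pred E 0ℓ

MaximalIn : {E : Set} → (Subset E → Set) → Subset E → Set₁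
MaximalIn {E} 𝓟 I = 𝓟 I × (∀ (J : Subset E) → 𝓟 J → I ⊆ J → J ⊆ I)

record Matroid (E : Set) : Set₁ where
  field
    Indep : Subset E → Set
    I1 : Indep ∅
    I2 : ∀ {I J : Subset E} → Indep I → J ⊆ I → Indep J
    I3 : ∀ {I I' : Subset E} → Indep I → ¬ MaximalIn Indep I → MaximalIn Indep I' →
         ∃ λ x → x ∈ I' × x ∉ I × Indep (I ∪ ｛ x ｝)
    IM : ∀ {I X : Subset E} → Indep I → I ⊆ X →
         ∃ λ I' → MaximalIn (λ J → Indep J × I ⊆ J × J ⊆ X) I'

module _ {E : Set} (M : Matroid E) where
  open Matroid M

  IsBasis : Subset E → Set₁
  IsBasis B = MaximalIn Indep B

  IsBasisOfRestriction : Subset E → Subset E → Set₁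
  IsBasisOfRestriction X B = MaximalIn (λ I → Indep I × I ⊆ X) B

HasSize : {E : Set} → Subset E → ℕ → Set
HasSize {E} F n = Σ (Fin n → E) λ f → Injective _≡_ _≡_ f × (∀ x → (x ∈ F) ⇔ (∃ λ i → f i ≡ x))

-- Cardinalities in ℕ ∪ {∞}: just n = n, nothing = ∞.
ℕ∞ : Set
ℕ∞ = Maybe ℕ

CardIs : {E : Set} → Subset E → ℕ∞ → Set
CardIs F (just n) = HasSize F n
CardIs F nothing = ∀ n → ¬ HasSize F n

module _ {E : Set} (M : Matroid E) where
  open Matroid M

  Deletable : Subset E → Subset E → Subset E → Set
  Deletable I J F = F ⊆ (I ∪ J) × Indep ((I ∪ J) ∖ F)

  DelIs : Subset E → Subset E → ℕ∞ → Set₁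
  DelIs I J (just n) =
    (∃ λ F → Deletable I J F × HasSize F n) ×
    (∀ (F : Subset E) (m : ℕ) → Deletable I J F → HasSize F m → n ≤ m)
  DelIs I J nothing = ∀ (F : Subset E) (m : ℕ) → Deletable I J F → ¬ HasSize F m

IsPartition : {E : Set} → Subset E → Subset E → Set
IsPartition {E} X Y = (∀ e → X e ⊎ Y e) × (∀ e → X e → Y e → ⊥)

-- (i): if (B_X ∪ B_Y) ∖ F is a basis and (B_X ∪ B_Y) ∖ F′ is independent, extend the
-- latter inside B_X ∪ B_Y to a basis S. Two bases contained in a set C have complements in C
-- of the same size (induct on the size of their difference, exchanging one element at a
-- time), so |F| = |(B_X ∪ B_Y) ∖ S| ≤ |F′|. Part (ii) is (i) because X and Y are disjoint.
-- For (iii): B_X spans X and B_Y spans Y, so every basis of M|(B_X ∪ B_Y) is a basis of M.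
-- One extending B_Y has the form (B_X ∖ F) ∪ B_Y, and then (B_X ∖ F) ∪ B′_Y is a basis for
-- every basis B′_Y of M|Y; by (ii) del(B_X, B_Y) = |F| = del(B_X, B′_Y). Exchanging the roles
-- of X and Y replaces B_X.
module Submission where

open import Defs
open import Level using (0ℓ; lift; lower)
open import Data.Nat using (ℕ; zero; suc; _≤_)
open import Data.Nat.Properties using (≤-antisym)
open import Data.Fin using (Fin; zero; suc; punchIn; punchOut)
open import Data.Fin.Properties
  using (¬Fin0; suc-injective; punchIn-injective; punchInᵢ≢i; punchIn-punchOut; injective⇒≤)
open import Data.Vec.Functional using (_∷_)
open import Data.Maybe using (just; nothing)
open import Data.Product using (Σ; ∃; _×_; _,_; proj₁; proj₂)
open import Data.Sum using (inj₁; inj₂; [_,_]′)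
import Data.Sum as Sum
open import Data.Empty using (⊥-elim)
open import Function using (_∘_; id)
open import Function.Bundles using (_⇔_; mk⇔; Equivalence)
open import Relation.Nullary using (¬_; Dec; yes; no; contradiction)
open import Relation.Nullary.Decidable using (map′; decidable-stable)
open import Relation.Binary.PropositionalEquality using (_≡_; refl; sym; trans; cong; subst)
open import Relation.Unary
  using (_∈_; _∉_; _⊆_; _≐_; _∪_; _∩_; _∖_; ｛_｝; U; Empty; Satisfiable; Decidable)
open import Axiom.ExcludedMiddle using (ExcludedMiddle)

open Equivalence using (to; from)

private
  variable
    m n : ℕ

module _ {E : Set} where

  private
    variable
      F G V W I J : Subset E
      x w : E

  HasSize-resp-≐ : F ≐ G → HasSize F n → HasSize G n
  HasSize-resp-≐ (F⊆G , G⊆F) (f , f-inj , f-enum) =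
    f , f-inj , λ x → mk⇔ (to (f-enum x) ∘ G⊆F) (F⊆G ∘ from (f-enum x))

  HasSize-mono : F ⊆ G → HasSize F m → HasSize G n → m ≤ n
  HasSize-mono F⊆G (f , f-inj , f-enum) (g , g-inj , g-enum) = injective⇒≤ h-inj
    where
      located : ∀ i → ∃ λ j → g j ≡ f i
      located i = to (g-enum (f i)) (F⊆G (from (f-enum (f i)) (i , refl)))
      h-inj : ∀ {i i′} → proj₁ (located i) ≡ proj₁ (located i′) → i ≡ i′
      h-inj {i} {i′} e =
        f-inj (trans (sym (proj₂ (located i))) (trans (cong g e) (proj₂ (located i′))))

  HasSize-unique : HasSize F m → HasSize F n → m ≡ n
  HasSize-unique F-m F-n = ≤-antisym (HasSize-mono id F-m F-n) (HasSize-mono id F-n F-m)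

  HasSize-zero⇒Empty : HasSize F 0 → Empty F
  HasSize-zero⇒Empty (f , _ , f-enum) x x∈F = ¬Fin0 (proj₁ (to (f-enum x) x∈F))

  Empty⇒HasSize-zero : Empty F → HasSize F 0
  Empty⇒HasSize-zero F-empty =
    (λ ()) , (λ {i} → ⊥-elim (¬Fin0 i)) ,
    λ x → mk⇔ (⊥-elim ∘ F-empty x) (λ (i , _) → ⊥-elim (¬Fin0 i))

  HasSize-suc⇒Satisfiable : HasSize F (suc n) → Satisfiable F
  HasSize-suc⇒Satisfiable (f , _ , f-enum) = f zero , from (f-enum (f zero)) (zero , refl)

  HasSize-insert : x ∉ F → HasSize F n → HasSize (F ∪ ｛ x ｝) (suc n)
  HasSize-insert {x = x} {F = F} x∉F (f , f-inj , f-enum) =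
    x ∷ f , g-inj , λ y → mk⇔ (g-to y) (g-from y)
    where
      g-inj : ∀ {i j} → (x ∷ f) i ≡ (x ∷ f) j → i ≡ j
      g-inj {zero}  {zero}  _ = refl
      g-inj {zero}  {suc j} e = contradiction (from (f-enum x) (j , sym e)) x∉F
      g-inj {suc i} {zero}  e = contradiction (from (f-enum x) (i , e)) x∉F
      g-inj {suc i} {suc j} e = cong suc (f-inj e)
      g-to : ∀ y → y ∈ F ∪ ｛ x ｝ → ∃ λ i → (x ∷ f) i ≡ y
      g-to y (inj₁ y∈F) = let i , e = to (f-enum y) y∈F in suc i , e
      g-to y (inj₂ x≡y) = zero , x≡y
      g-from : ∀ y → (∃ λ i → (x ∷ f) i ≡ y) → y ∈ F ∪ ｛ x ｝
      g-from y (zero  , e) = inj₂ e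
      g-from y (suc i , e) = inj₁ (from (f-enum y) (i , e))

  HasSize-remove : x ∈ F → HasSize F (suc n) → HasSize (F ∖ ｛ x ｝) n
  HasSize-remove {x = x} {F = F} {n = n} x∈F (f , f-inj , f-enum) =
    f ∘ punchIn i , (λ e → punchIn-injective i _ _ (f-inj e)) , λ y → mk⇔ (g-to y) (g-from y)
    where
      i : Fin (suc n)
      i = proj₁ (to (f-enum x) x∈F)
      fi≡x : f i ≡ x
      fi≡x = proj₂ (to (f-enum x) x∈F)
      g-to : ∀ y → y ∈ F ∖ ｛ x ｝ → ∃ λ j → f (punchIn i j) ≡ y
      g-to y (y∈F , x≢y) =
        let j , fj≡y = to (f-enum y) y∈F
            i≢j : ¬ i ≡ j
            i≢j i≡j = x≢y (trans (sym fi≡x) (trans (cong f i≡j) fj≡y))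
        in punchOut i≢j , trans (cong f (punchIn-punchOut i≢j)) fj≡y
      g-from : ∀ y → (∃ λ j → f (punchIn i j) ≡ y) → y ∈ F ∖ ｛ x ｝
      g-from y (j , e) =
        from (f-enum y) (punchIn i j , e) ,
        λ x≡y → punchInᵢ≢i i j (f-inj (trans e (trans (sym x≡y) (sym fi≡x))))

  HasSize-swap : x ∈ F → w ∉ F ∖ ｛ x ｝ → HasSize F m →
                 HasSize ((F ∖ ｛ x ｝) ∪ ｛ w ｝) m
  HasSize-swap {m = zero}  x∈F _ F-size = contradiction x∈F (HasSize-zero⇒Empty F-size _)
  HasSize-swap {m = suc m} x∈F w∉F-x F-size = HasSize-insert w∉F-x (HasSize-remove x∈F F-size)

  insert-⊆ : F ⊆ G → x ∈ G → F ∪ ｛ x ｝ ⊆ G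
  insert-⊆ {G = G} F⊆G x∈G = [ F⊆G , (λ x≡y → subst G x≡y x∈G) ]′

  partition-disjoint : IsPartition V W → I ⊆ V → J ⊆ W → Empty (I ∩ J)
  partition-disjoint (_ , disjoint) I⊆V J⊆W u (u∈I , u∈J) = disjoint u (I⊆V u∈I) (J⊆W u∈J)

  IsPartition-swap : IsPartition V W → IsPartition W V
  IsPartition-swap (cover , disjoint) = Sum.swap ∘ cover , λ u u∈W u∈V → disjoint u u∈V u∈W

private
  HasSize-suc-shift : ∀ {P : Subset (Fin (suc n))} →
                      HasSize (P ∘ suc) m → HasSize (P ∖ ｛ zero ｝) m
  HasSize-suc-shift {P = P} (h , h-inj , h-enum) = suc ∘ h , (λ e → h-inj (suc-injective e)) , enum
    where
      enum : ∀ i → i ∈ P ∖ ｛ zero ｝ ⇔ ∃ λ j → suc (h j) ≡ i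
      enum zero    = mk⇔ (λ (_ , 0≢0) → contradiction refl 0≢0) (λ { (_ , ()) })
      enum (suc i) = mk⇔ (λ (Pi , _) → let j , e = to (h-enum i) Pi in j , cong suc e)
                         (λ (j , e) → from (h-enum i) (j , suc-injective e) , λ ())

Decidable⇒HasSize : ∀ {P : Subset (Fin n)} → Decidable P → ∃ (HasSize P)
Decidable⇒HasSize {n = zero} P? = 0 , Empty⇒HasSize-zero (λ ())
Decidable⇒HasSize {n = suc n} {P} P? with Decidable⇒HasSize {P = P ∘ suc} (P? ∘ suc) | P? zero
... | m , tail-size | yes P0 =
  suc m , HasSize-resp-≐ (unrestore , restore)
                         (HasSize-insert (λ (_ , 0≢0) → 0≢0 refl) (HasSize-suc-shift tail-size))
  where
    restore : P ⊆ (P ∖ ｛ zero ｝) ∪ ｛ zero ｝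
    restore {zero}  _  = inj₂ refl
    restore {suc i} Pi = inj₁ (Pi , λ ())
    unrestore : (P ∖ ｛ zero ｝) ∪ ｛ zero ｝ ⊆ P
    unrestore (inj₁ (Pi , _)) = Pi
    unrestore (inj₂ refl)     = P0
... | m , tail-size | no ¬P0 = m , HasSize-resp-≐ (proj₁ , drop) (HasSize-suc-shift tail-size)
  where
    drop : P ⊆ P ∖ ｛ zero ｝
    drop {zero}  P0 = contradiction P0 ¬P0
    drop {suc i} Pi = Pi , λ ()

HasSize-⊆ : {E : Set} {F G : Subset E} → Decidable G → G ⊆ F → HasSize F n →
            ∃ λ m → m ≤ n × HasSize G m
HasSize-⊆ {G = G} G? G⊆F F-size@(f , f-inj , f-enum)
  with Decidable⇒HasSize {P = G ∘ f} (G? ∘ f)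
... | m , (h , h-inj , h-enum) = m , HasSize-mono G⊆F G-size F-size , G-size
  where
    G-to : ∀ y → y ∈ G → ∃ λ j → f (h j) ≡ y
    G-to y y∈G =
      let i , fi≡y = to (f-enum y) (G⊆F y∈G)
          j , hj≡i = to (h-enum i) (subst G (sym fi≡y) y∈G)
      in j , trans (cong f hj≡i) fi≡y
    G-size : HasSize G m
    G-size = f ∘ h , (λ e → h-inj (f-inj e)) ,
             λ y → mk⇔ (G-to y) (λ (j , e) → subst G e (from (h-enum (h j)) (j , refl)))

module Classical (em : ExcludedMiddle (Level.suc 0ℓ)) where

  dec : (P : Set) → Dec P
  dec P = map′ lower lift em

  ¬¬-elim : {P : Set} → ¬ ¬ P → P
  ¬¬-elim {P} = decidable-stable (dec P)

  ¬¬-elim₁ : {P : Set₁} → ¬ ¬ P → P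
  ¬¬-elim₁ = decidable-stable em

  split-off : {E : Set} {A : Subset E} {x : E} → A ⊆ (A ∖ ｛ x ｝) ∪ ｛ x ｝
  split-off {x = x} {y} y∈A with dec (x ≡ y)
  ... | yes x≡y = inj₂ x≡y
  ... | no x≢y  = inj₁ (y∈A , x≢y)

  decidable : {E : Set} (P : Subset E) → Decidable P
  decidable P x = dec (x ∈ P)

  cardinality : {E : Set} (F : Subset E) → Σ ℕ∞ (CardIs F)
  cardinality F with dec (∃ (HasSize F))
  ... | yes (n , F-size) = just n , F-size
  ... | no infinite     = nothing , λ n F-size → infinite (n , F-size)

module MatroidTheory (em : ExcludedMiddle (Level.suc 0ℓ)) {E : Set} (M : Matroid E) where

  open Classical em
  open Matroid M

  private
    variable
      A B C F G I I′ J J′ K L S V W Z : Subset E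
      x y z : E

  basis-maximal : IsBasis M K → Indep J → K ⊆ J → J ⊆ K
  basis-maximal K-basis J-indep = proj₂ K-basis _ J-indep

  basis-absorbs : IsBasis M K → Indep (K ∪ ｛ x ｝) → x ∈ K
  basis-absorbs K-basis K+x-indep = basis-maximal K-basis K+x-indep inj₁ (inj₂ refl)

  basisOfRestriction-absorbs : IsBasisOfRestriction M Z S → x ∈ Z → Indep (S ∪ ｛ x ｝) → x ∈ S
  basisOfRestriction-absorbs S-basis x∈Z S+x-indep =
    proj₂ S-basis _ (S+x-indep , insert-⊆ (proj₂ (proj₁ S-basis)) x∈Z) inj₁ (inj₂ refl)

  ∩⊆basisOfRestriction : IsBasisOfRestriction M V S → S ⊆ K → Indep K → K ∩ V ⊆ S
  ∩⊆basisOfRestriction S-basis S⊆K K-indep (x∈K , x∈V) =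
    basisOfRestriction-absorbs S-basis x∈V (I2 K-indep (insert-⊆ S⊆K x∈K))

  IsBasis-resp-≐ : A ≐ B → IsBasis M A → IsBasis M B
  IsBasis-resp-≐ (A⊆B , B⊆A) A-basis =
    I2 (proj₁ A-basis) B⊆A , λ J J-indep B⊆J → A⊆B ∘ basis-maximal A-basis J-indep (B⊆J ∘ A⊆B)

  extend-to-basisOfRestriction : Indep I → I ⊆ Z → ∃ λ S → I ⊆ S × IsBasisOfRestriction M Z S
  extend-to-basisOfRestriction I-indep I⊆Z with IM I-indep I⊆Z
  ... | S , (S-indep , I⊆S , S⊆Z) , S-maximal =
    S , I⊆S , (S-indep , S⊆Z) ,
    λ J (J-indep , J⊆Z) S⊆J → S-maximal J (J-indep , S⊆J ∘ I⊆S , J⊆Z) S⊆J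

  basisOfRestriction-full : (∀ x → x ∈ Z) → IsBasisOfRestriction M Z S → IsBasis M S
  basisOfRestriction-full everything S-basis =
    proj₁ (proj₁ S-basis) , λ J J-indep → proj₂ S-basis J (J-indep , λ {x} _ → everything x)

  basis-exists : ∃ (IsBasis M)
  basis-exists with extend-to-basisOfRestriction {Z = U} I1 (λ ())
  ... | S , _ , S-basis = S , basisOfRestriction-full _ S-basis

  extend-to-basis-within : Indep I → IsBasis M K → ∃ λ L → IsBasis M L × I ⊆ L × L ⊆ I ∪ K
  extend-to-basis-within I-indep K-basis with extend-to-basisOfRestriction I-indep inj₁
  ... | S , I⊆S , S-basis = S , S-basis′ , I⊆S , proj₂ (proj₁ S-basis)
    where
      S-basis′ : IsBasis M _
      S-basis′ = ¬¬-elim₁ λ ¬basis →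
        let v , v∈K , v∉S , S+v-indep = I3 (proj₁ (proj₁ S-basis)) ¬basis K-basis
        in v∉S (basisOfRestriction-absorbs S-basis (inj₂ v∈K) S+v-indep)

  basis-remove-augment : IsBasis M K → x ∈ K → IsBasis M L →
                         ∃ λ v → v ∈ L × v ∉ K ∖ ｛ x ｝ × Indep ((K ∖ ｛ x ｝) ∪ ｛ v ｝)
  basis-remove-augment K-basis x∈K L-basis = I3 (I2 (proj₁ K-basis) proj₁) ¬basis L-basis
    where
      ¬basis : ¬ IsBasis M _
      ¬basis K-x-basis = proj₂ (basis-maximal K-x-basis (proj₁ K-basis) proj₁ x∈K) refl

  basis-exchange : IsBasis M K → x ∈ K → y ∉ K → Indep ((K ∖ ｛ x ｝) ∪ ｛ y ｝) →
                   IsBasis M ((K ∖ ｛ x ｝) ∪ ｛ y ｝)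
  basis-exchange {K} {x} {y} K-basis x∈K y∉K K′-indep = ¬¬-elim₁ refute
    where
      refute : ¬ ¬ IsBasis M ((K ∖ ｛ x ｝) ∪ ｛ y ｝)
      refute ¬basis with I3 K′-indep ¬basis K-basis
      ... | v , v∈K , v∉K′ , K′+v-indep = y∉K (basis-absorbs K-basis (I2 K′+x-indep K+y⊆K′+x))
        where
          K′+x-indep : Indep (((K ∖ ｛ x ｝) ∪ ｛ y ｝) ∪ ｛ x ｝)
          K′+x-indep = subst (λ u → Indep (_ ∪ ｛ u ｝))
                             (¬¬-elim λ v≢x → v∉K′ (inj₁ (v∈K , v≢x ∘ sym))) K′+v-indep
          K+y⊆K′+x : K ∪ ｛ y ｝ ⊆ ((K ∖ ｛ x ｝) ∪ ｛ y ｝) ∪ ｛ x ｝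
          K+y⊆K′+x = [ [ inj₁ ∘ inj₁ , inj₂ ]′ ∘ split-off {A = K} , inj₁ ∘ inj₂ ]′

  symmetric-exchange : IsBasis M K → IsBasis M L → x ∈ K ∖ L →
                       ∃ λ y → y ∈ L ∖ K × IsBasis M ((K ∖ ｛ x ｝) ∪ ｛ y ｝)
  symmetric-exchange {K} {L} {x} K-basis L-basis (x∈K , x∉L) =
    let y , y∈L , y∉K-x , K′-indep = basis-remove-augment K-basis x∈K L-basis
        y∉K : y ∉ K
        y∉K y∈K = x∉L (subst L (sym (¬¬-elim λ x≢y → y∉K-x (y∈K , x≢y))) y∈L)
    in y , (y∈L , y∉K) , basis-exchange K-basis x∈K y∉K K′-indep

  basis-complement-HasSize : ∀ n {m} → IsBasis M K → IsBasis M L → K ⊆ C → L ⊆ C →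
                             HasSize (L ∖ K) n → HasSize (C ∖ K) m → HasSize (C ∖ L) m
  basis-complement-HasSize {K} {L} zero K-basis L-basis _ _ L∖K-size =
    HasSize-resp-≐ ((λ (u∈C , u∉K) → u∈C , u∉K ∘ L⊆K) , (λ (u∈C , u∉L) → u∈C , u∉L ∘ K⊆L))
    where
      L⊆K : L ⊆ K
      L⊆K u∈L = ¬¬-elim λ u∉K → HasSize-zero⇒Empty L∖K-size _ (u∈L , u∉K)
      K⊆L : K ⊆ L
      K⊆L = basis-maximal L-basis (proj₁ K-basis) L⊆K
  basis-complement-HasSize {K} {L} {C} (suc n) {m} K-basis L-basis K⊆C L⊆C L∖K-size C∖K-size
    with HasSize-suc⇒Satisfiable L∖K-size
  ... | x , x∈L , x∉K with symmetric-exchange L-basis K-basis (x∈L , x∉K)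
  ... | y , (y∈K , y∉L) , L′-basis =
    HasSize-resp-≐ (swapped⊆C∖L , C∖L⊆swapped)
      (HasSize-swap (L⊆C x∈L , x∉L′) (λ ((_ , y∉L′) , _) → y∉L′ (inj₂ refl)) C∖L′-size)
    where
      L′ : Subset E
      L′ = (L ∖ ｛ x ｝) ∪ ｛ y ｝
      x∉L′ : x ∉ L′
      x∉L′ = [ (λ (_ , x≢x) → x≢x refl) , (λ y≡x → x∉K (subst K y≡x y∈K)) ]′
      L∖K-x≐L′∖K : (L ∖ K) ∖ ｛ x ｝ ≐ L′ ∖ K
      L∖K-x≐L′∖K =
        (λ ((u∈L , u∉K) , x≢u) → inj₁ (u∈L , x≢u) , u∉K) ,
        λ { (inj₁ (u∈L , x≢u) , u∉K) → (u∈L , u∉K) , x≢u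
          ; (inj₂ y≡u , u∉K) → contradiction (subst K y≡u y∈K) u∉K }
      C∖L′-size : HasSize (C ∖ L′) m
      C∖L′-size = basis-complement-HasSize n K-basis L′-basis K⊆C
        (insert-⊆ {F = L ∖ ｛ x ｝} (L⊆C ∘ proj₁) (K⊆C y∈K))
        (HasSize-resp-≐ L∖K-x≐L′∖K (HasSize-remove (x∈L , x∉K) L∖K-size))
        C∖K-size
      swapped⊆C∖L : ((C ∖ L′) ∖ ｛ x ｝) ∪ ｛ y ｝ ⊆ C ∖ L
      swapped⊆C∖L (inj₁ ((u∈C , u∉L′) , x≢u)) = u∈C , λ u∈L → u∉L′ (inj₁ (u∈L , x≢u))
      swapped⊆C∖L (inj₂ y≡u) = subst C y≡u (K⊆C y∈K) , λ u∈L → y∉L (subst L (sym y≡u) u∈L)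
      C∖L⊆swapped : C ∖ L ⊆ ((C ∖ L′) ∖ ｛ x ｝) ∪ ｛ y ｝
      C∖L⊆swapped u∈C∖L with split-off {A = C ∖ L} {x = y} u∈C∖L
      ... | inj₂ y≡u = inj₂ y≡u
      ... | inj₁ ((u∈C , u∉L) , y≢u) =
        inj₁ ((u∈C , [ u∉L ∘ proj₁ , y≢u ]′) , λ x≡u → u∉L (subst L x≡u x∈L))

  augment-in-restriction : IsBasisOfRestriction M Z J → Indep I → I ⊆ Z → z ∈ Z → z ∉ I →
                           Indep (I ∪ ｛ z ｝) → ∃ λ y → y ∈ J × y ∉ I × Indep (I ∪ ｛ y ｝)
  augment-in-restriction {J = J} {I = I} {z = z} J-basis I-indep I⊆Z z∈Z z∉I I+z-indep
    with dec (z ∈ J)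
  ... | yes z∈J = z , z∈J , z∉I , I+z-indep
  ... | no z∉J
    with extend-to-basis-within (proj₁ (proj₁ J-basis)) (proj₂ basis-exists)
  ... | B , B-basis , J⊆B , _
    with extend-to-basis-within I+z-indep B-basis
  ... | B₁ , B₁-basis , I+z⊆B₁ , B₁⊆I+z∪B
    with extend-to-basis-within (proj₁ (proj₁ J-basis)) B₁-basis
  ... | B₂ , B₂-basis , J⊆B₂ , B₂⊆J∪B₁
    with basis-remove-augment B₁-basis (I+z⊆B₁ (inj₂ refl)) B-basis
  ... | v , v∈B , v∉B₁-z , B₁-z+v-indep =
    v , v∈J , v∉B₁ ∘ I+z⊆B₁ ∘ inj₁ , I2 B₁-z+v-indep I+v⊆B₁-z+v
    where
      -- A basis of M containing J meets Z only inside J. Applied to B₂ this gives B₂ ⊆ B,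
      -- hence B ⊆ J ∪ B₁, so the element v that B contributes to B₁ ∖ ｛ z ｝ lies in J.
      B₂⊆B : B₂ ⊆ B
      B₂⊆B u∈B₂ with B₂⊆J∪B₁ u∈B₂
      ... | inj₁ u∈J = J⊆B u∈J
      ... | inj₂ u∈B₁ with B₁⊆I+z∪B u∈B₁
      ...   | inj₂ u∈B   = u∈B
      ...   | inj₁ u∈I+z =
        J⊆B (∩⊆basisOfRestriction J-basis J⊆B₂ (proj₁ B₂-basis) (u∈B₂ , insert-⊆ I⊆Z z∈Z u∈I+z))
      B⊆J∪B₁ : B ⊆ J ∪ B₁
      B⊆J∪B₁ = B₂⊆J∪B₁ ∘ basis-maximal B₂-basis (proj₁ B-basis) B₂⊆B
      v∉B₁ : v ∉ B₁
      v∉B₁ v∈B₁ = z∉J (∩⊆basisOfRestriction J-basis J⊆B (proj₁ B-basis) (z∈B , z∈Z))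
        where
          z∈B : z ∈ B
          z∈B = subst B (sym (¬¬-elim λ z≢v → v∉B₁-z (v∈B₁ , z≢v))) v∈B
      v∈J : v ∈ J
      v∈J = [ id , (λ v∈B₁ → contradiction v∈B₁ v∉B₁) ]′ (B⊆J∪B₁ v∈B)
      I+v⊆B₁-z+v : I ∪ ｛ v ｝ ⊆ (B₁ ∖ ｛ z ｝) ∪ ｛ v ｝
      I+v⊆B₁-z+v =
        [ (λ u∈I → inj₁ (I+z⊆B₁ (inj₁ u∈I) , λ z≡u → z∉I (subst I (sym z≡u) u∈I))) , inj₂ ]′

  basisOfRestriction-∪ : IsBasisOfRestriction M W J → J ⊆ B → IsBasisOfRestriction M B S →
                         IsBasisOfRestriction M (B ∪ W) S
  basisOfRestriction-∪ {W} {J} {B} {S} J-basis J⊆B S-basis =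
    (S-indep , inj₁ ∘ S⊆B) , λ K (K-indep , K⊆B∪W) S⊆K u∈K →
      absorbs (I2 K-indep (insert-⊆ S⊆K u∈K)) (K⊆B∪W u∈K)
    where
      S-indep : Indep S
      S-indep = proj₁ (proj₁ S-basis)
      S⊆B : S ⊆ B
      S⊆B = proj₂ (proj₁ S-basis)
      -- J spans W, so a basis K of M|(B ∪ ｛ x ｝) through J avoids x and lies in B;
      -- K would then augment S inside B.
      outside-dependent : x ∈ W → x ∉ B → ¬ Indep (S ∪ ｛ x ｝)
      outside-dependent {x} x∈W x∉B S+x-indep
        with extend-to-basisOfRestriction (proj₁ (proj₁ J-basis)) (inj₁ ∘ J⊆B)
      ... | K , J⊆K , K-basis
        with augment-in-restriction K-basis S-indep (inj₁ ∘ S⊆B) (inj₂ refl) (x∉B ∘ S⊆B) S+x-indep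
      ... | y , y∈K , y∉S , S+y-indep = y∉S (basisOfRestriction-absorbs S-basis (K⊆B y∈K) S+y-indep)
        where
          K⊆B : K ⊆ B
          K⊆B u∈K with proj₂ (proj₁ K-basis) u∈K
          ... | inj₁ u∈B = u∈B
          ... | inj₂ x≡u = contradiction (J⊆B x∈J) x∉B
            where
              x∈J : x ∈ J
              x∈J = ∩⊆basisOfRestriction J-basis J⊆K (proj₁ (proj₁ K-basis))
                                         (subst K (sym x≡u) u∈K , x∈W)
      absorbs : Indep (S ∪ ｛ x ｝) → x ∈ B ∪ W → x ∈ S
      absorbs S+x-indep (inj₁ x∈B) = basisOfRestriction-absorbs S-basis x∈B S+x-indep
      absorbs {x} S+x-indep (inj₂ x∈W) with dec (x ∈ B)
      ... | yes x∈B = basisOfRestriction-absorbs S-basis x∈B S+x-indep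
      ... | no x∉B  = contradiction S+x-indep (outside-dependent x∈W x∉B)

  basisOfRestriction-cover⇒basis : (∀ x → x ∈ V ∪ W) →
    IsBasisOfRestriction M V I → IsBasisOfRestriction M W J →
    IsBasisOfRestriction M (I ∪ J) S → IsBasis M S
  basisOfRestriction-cover⇒basis cover I-basis J-basis S-basis =
    basisOfRestriction-full (λ x → [ inj₁ ∘ inj₂ , inj₂ ]′ (cover x))
      (basisOfRestriction-∪ J-basis (inj₁ ∘ inj₂) (basisOfRestriction-∪ I-basis inj₁ S-basis))

  restriction-basis-replace : Empty (A ∩ V) →
                              IsBasisOfRestriction M V I → IsBasisOfRestriction M V J →
                              IsBasis M (A ∪ I) → IsBasis M (A ∪ J)
  restriction-basis-replace {A} {V} {I} {J} A∩V-empty I-basis J-basis A∪I-basis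
    with extend-to-basis-within (proj₁ (proj₁ J-basis)) A∪I-basis
  ... | K , K-basis , J⊆K , K⊆J∪A∪I
    with extend-to-basis-within (proj₁ (proj₁ I-basis)) K-basis
  ... | L , L-basis , I⊆L , L⊆I∪K = IsBasis-resp-≐ (K⊆A∪J , [ A⊆K , J⊆K ]′) K-basis
    where
      K⊆A∪J : K ⊆ A ∪ J
      K⊆A∪J {u} u∈K with K⊆J∪A∪I u∈K
      ... | inj₁ u∈J          = inj₂ u∈J
      ... | inj₂ (inj₁ u∈A)   = inj₁ u∈A
      ... | inj₂ (inj₂ u∈I)   =
        inj₂ (∩⊆basisOfRestriction J-basis J⊆K (proj₁ K-basis) (u∈K , proj₂ (proj₁ I-basis) u∈I))
      L⊆A∪I : L ⊆ A ∪ I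
      L⊆A∪I {u} u∈L with L⊆I∪K u∈L
      ... | inj₁ u∈I = inj₂ u∈I
      ... | inj₂ u∈K with K⊆A∪J u∈K
      ...   | inj₁ u∈A = inj₁ u∈A
      ...   | inj₂ u∈J =
        inj₂ (∩⊆basisOfRestriction I-basis I⊆L (proj₁ L-basis) (u∈L , proj₂ (proj₁ J-basis) u∈J))
      A⊆K : A ⊆ K
      A⊆K {u} u∈A with L⊆I∪K (basis-maximal L-basis (proj₁ A∪I-basis) L⊆A∪I (inj₁ u∈A))
      ... | inj₁ u∈I = contradiction (u∈A , proj₂ (proj₁ I-basis) u∈I) (A∩V-empty u)
      ... | inj₂ u∈K = u∈K

  Deletable-swap : Deletable M I J F → Deletable M J I F
  Deletable-swap (F⊆I∪J , rest-indep) =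
    Sum.swap ∘ F⊆I∪J , I2 rest-indep (λ (u∈J∪I , u∉F) → Sum.swap u∈J∪I , u∉F)

  DelIs-swap : ∀ k → DelIs M I J k → DelIs M J I k
  DelIs-swap (just n) ((F , F-del , F-size) , minimal) =
    (F , Deletable-swap F-del , F-size) , λ G m → minimal G m ∘ Deletable-swap
  DelIs-swap nothing none G m = none G m ∘ Deletable-swap

  DelIs-unique : ∀ k k′ → DelIs M I J k → DelIs M I J k′ → k ≡ k′
  DelIs-unique (just n) (just n′) ((F , F-del , F-size) , minimal)
                                  ((F′ , F′-del , F′-size) , minimal′) =
    cong just (≤-antisym (minimal F′ n′ F′-del F′-size) (minimal′ F n F-del F-size))
  DelIs-unique (just n) nothing ((F , F-del , F-size) , _) none =
    contradiction F-size (none F n F-del)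
  DelIs-unique nothing (just n′) none ((F′ , F′-del , F′-size) , _) =
    contradiction F′-size (none F′ n′ F′-del)
  DelIs-unique nothing nothing _ _ = refl

  Deletable⇒HasSize : F ⊆ I ∪ J → IsBasis M ((I ∪ J) ∖ F) → Deletable M I J G → HasSize G m →
                      ∃ λ m′ → m′ ≤ m × HasSize F m′
  Deletable⇒HasSize {F} {I} {J} {G} F⊆I∪J rest-basis (_ , I∪J∖G-indep) G-size
    with extend-to-basis-within I∪J∖G-indep rest-basis
  ... | S , S-basis , I∪J∖G⊆S , S⊆I∪J∖G∪I∪J∖F
    with HasSize-⊆ (decidable _)
           (λ (u∈I∪J , u∉S) → ¬¬-elim λ u∉G → u∉S (I∪J∖G⊆S (u∈I∪J , u∉G))) G-size
  ... | m′ , m′≤m , I∪J∖S-size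
    with HasSize-⊆ (decidable _) (λ ((u∈I∪J , _) , u∉S) → u∈I∪J , u∉S) I∪J∖S-size
  ... | n , _ , difference-size =
    m′ , m′≤m ,
    HasSize-resp-≐ double-complement
      (basis-complement-HasSize n S-basis rest-basis S⊆I∪J proj₁ difference-size I∪J∖S-size)
    where
      S⊆I∪J : S ⊆ I ∪ J
      S⊆I∪J = [ proj₁ , proj₁ ]′ ∘ S⊆I∪J∖G∪I∪J∖F
      double-complement : (I ∪ J) ∖ ((I ∪ J) ∖ F) ≐ F
      double-complement =
        (λ (u∈I∪J , ¬u∈I∪J∖F) → ¬¬-elim λ u∉F → ¬u∈I∪J∖F (u∈I∪J , u∉F)) ,
        λ u∈F → F⊆I∪J u∈F , λ (_ , u∉F) → u∉F u∈F

  DelIs-basis-complement : F ⊆ I ∪ J → IsBasis M ((I ∪ J) ∖ F) → ∀ k → CardIs F k → DelIs M I J k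
  DelIs-basis-complement {F} F⊆I∪J rest-basis (just n) F-size =
    (F , (F⊆I∪J , proj₁ rest-basis) , F-size) , λ G m G-del G-size →
      let m′ , m′≤m , F-size′ = Deletable⇒HasSize F⊆I∪J rest-basis G-del G-size
      in subst (_≤ m) (HasSize-unique F-size′ F-size) m′≤m
  DelIs-basis-complement F⊆I∪J rest-basis nothing F-infinite G m G-del G-size =
    let m′ , _ , F-size = Deletable⇒HasSize F⊆I∪J rest-basis G-del G-size
    in F-infinite m′ F-size

  DelIs-basis-complement-left : Empty (I ∩ J) → F ⊆ I → IsBasis M ((I ∖ F) ∪ J) →
                                ∀ k → CardIs F k → DelIs M I J k
  DelIs-basis-complement-left {I} {J} {F} I∩J-empty F⊆I rest-basis =
    DelIs-basis-complement (inj₁ ∘ F⊆I) (IsBasis-resp-≐ (rearrange , regroup) rest-basis)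
    where
      rearrange : (I ∖ F) ∪ J ⊆ (I ∪ J) ∖ F
      rearrange = [ (λ (u∈I , u∉F) → inj₁ u∈I , u∉F) ,
                    (λ u∈J → inj₂ u∈J , λ u∈F → I∩J-empty _ (F⊆I u∈F , u∈J)) ]′
      regroup : (I ∪ J) ∖ F ⊆ (I ∖ F) ∪ J
      regroup (u∈I∪J , u∉F) = [ (λ u∈I → inj₁ (u∈I , u∉F)) , inj₂ ]′ u∈I∪J

  DelIs-replace-right : IsPartition V W → IsBasisOfRestriction M V I →
                        IsBasisOfRestriction M W J → IsBasisOfRestriction M W J′ →
                        ∃ λ k → DelIs M I J k × DelIs M I J′ k
  DelIs-replace-right {V} {W} {I} {J} {J′} V,W I-basis J-basis J′-basis
    with extend-to-basisOfRestriction {Z = I ∪ J} (proj₁ (proj₁ J-basis)) inj₂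
  ... | S , J⊆S , S-basis =
    k , DelIs-basis-complement-left (partition-disjoint V,W I⊆V (proj₂ (proj₁ J-basis))) proj₁
          kept∪J-basis k dropped-card
      , DelIs-basis-complement-left (partition-disjoint V,W I⊆V (proj₂ (proj₁ J′-basis))) proj₁
          (restriction-basis-replace (partition-disjoint V,W (I⊆V ∘ proj₁) id)
             J-basis J′-basis kept∪J-basis) k dropped-card
    where
      I⊆V : I ⊆ V
      I⊆V = proj₂ (proj₁ I-basis)
      dropped : Subset E
      dropped = I ∖ S
      k : ℕ∞
      k = proj₁ (cardinality dropped)
      dropped-card : CardIs dropped k
      dropped-card = proj₂ (cardinality dropped)
      kept∪J-basis : IsBasis M ((I ∖ dropped) ∪ J)
      kept∪J-basis = IsBasis-resp-≐ (S⊆kept∪J , [ kept⊆S , J⊆S ]′)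
                       (basisOfRestriction-cover⇒basis (proj₁ V,W) I-basis J-basis S-basis)
        where
          S⊆kept∪J : S ⊆ (I ∖ dropped) ∪ J
          S⊆kept∪J u∈S = [ (λ u∈I → inj₁ (u∈I , λ (_ , u∉S) → u∉S u∈S)) , inj₂ ]′
                           (proj₂ (proj₁ S-basis) u∈S)
          kept⊆S : I ∖ dropped ⊆ S
          kept⊆S (u∈I , u∉dropped) = ¬¬-elim λ u∉S → u∉dropped (u∈I , u∉S)

  DelIs-independent-of-bases : IsPartition V W →
    IsBasisOfRestriction M V I → IsBasisOfRestriction M W J →
    IsBasisOfRestriction M V I′ → IsBasisOfRestriction M W J′ →
    ∃ λ k → DelIs M I J k × DelIs M I′ J′ k
  DelIs-independent-of-bases {I′ = I′} {J′ = J′} V,W I-basis J-basis I′-basis J′-basis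
    with DelIs-replace-right V,W I-basis J-basis J′-basis
       | DelIs-replace-right (IsPartition-swap V,W) J′-basis I-basis I′-basis
  ... | k , del-IJ , del-IJ′ | k′ , del-J′I , del-J′I′ =
    k , del-IJ , DelIs-swap k (subst (DelIs M J′ I′) (sym k≡k′) del-J′I′)
    where
      k≡k′ : k ≡ k′
      k≡k′ = DelIs-unique k k′ del-IJ′ (DelIs-swap k′ del-J′I)

lemma14 : (lem : ExcludedMiddle (Level.suc 0ℓ))
          {E : Set} (M : Matroid E) (X Y : Subset E) → IsPartition X Y →
          (BX BY : Subset E) → IsBasisOfRestriction M X BX → IsBasisOfRestriction M Y BY →
          ((F : Subset E) → F ⊆ (BX ∪ BY) → IsBasis M ((BX ∪ BY) ∖ F) →
            Σ ℕ∞ (λ k → CardIs F k × DelIs M BX BY k))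
          × ((F : Subset E) → F ⊆ BX → IsBasis M ((BX ∖ F) ∪ BY) →
            Σ ℕ∞ (λ k → CardIs F k × DelIs M BX BY k))
          × ((BX' BY' : Subset E) → IsBasisOfRestriction M X BX' → IsBasisOfRestriction M Y BY' →
            Σ ℕ∞ (λ k → DelIs M BX BY k × DelIs M BX' BY' k))
lemma14 lem M X Y X,Y BX BY BX-basis BY-basis =
  (λ F F⊆BX∪BY rest-basis →
     let k , F-card = cardinality F
     in k , F-card , DelIs-basis-complement F⊆BX∪BY rest-basis k F-card) ,
  (λ F F⊆BX rest-basis →
     let k , F-card = cardinality F
     in k , F-card , DelIs-basis-complement-left BX∩BY-empty F⊆BX rest-basis k F-card) ,
  (λ _ _ → DelIs-independent-of-bases X,Y BX-basis BY-basis)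
  where
    open Classical lem
    open MatroidTheory lem M
    BX∩BY-empty : Empty (BX ∩ BY)
    BX∩BY-empty = partition-disjoint X,Y (proj₂ (proj₁ BX-basis)) (proj₂ (proj₁ BY-basis))
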